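{- Let $G$ and $H$ be simple graphs such that $G$ contains an induced subgraph that is a subdivision of $H$. Then ${\rm ava}(G)\ge{\rm ava}(H)$.
   Context: A \emph{complete arboreal coloring} of a graph $G$ is a partition of $V(G)$ into color classes each inducing a forest such that the union of any two distinct color classes induces a subgraph containing a cycle; ${\rm ava}(G)$ is the maximum number of colors in such a coloring. -}

module Defs where

open import Data.Nat using (ℕ; zero; suc; _≤_; _+_)
open import Data.Fin using (Fin; zero; suc; inject₁; fromℕ; _≟_)
open import Data.Bool using (Bool; true; false; _∧_; _∨_; not)
open import Data.Product using (Σ; _×_; _,_; ∃)
open import Data.Sum using (_⊎_)
open import Relation.Nullary using (¬_)
open import Relation.Nullary.Decidable using (⌊_⌋)
open import Relation.Binary.PropositionalEquality using (_≡_; _≢_)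
open import Function.Definitions using (Injective; Surjective)

record Graph : Set where
  constructor mkGraph
  field
    n   : ℕ
    adj : Fin n → Fin n → Bool
open Graph public

IsSimple : Graph → Set
IsSimple G = (∀ u v → adj G u v ≡ adj G v u) × (∀ u → adj G u u ≡ false)

-- G contains a cycle all of whose vertices satisfy P (i.e. the subgraph
-- induced by P contains a cycle): distinct vertices w 0, …, w (k+2),
-- consecutive ones adjacent, and the last adjacent to the first.
HasCycleIn : (G : Graph) → (Fin (n G) → Set) → Set
HasCycleIn G P =
  Σ ℕ λ k → Σ (Fin (3 + k) → Fin (n G)) λ w →
    Injective _≡_ _≡_ w
    × (∀ i → P (w i))
    × (∀ (i : Fin (2 + k)) → adj G (w (inject₁ i)) (w (suc i)) ≡ true)
    × (adj G (w (fromℕ (2 + k))) (w zero) ≡ true)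

InducesForest : (G : Graph) → (Fin (n G) → Set) → Set
InducesForest G P = ¬ HasCycleIn G P

-- A complete arboreal coloring with k colors: a partition of V(G) into k
-- (nonempty) color classes, given by a surjective map c, each class
-- inducing a forest, and any two distinct classes together inducing a
-- subgraph containing a cycle.
IsCompleteArborealColoring : (G : Graph) (k : ℕ) → (Fin (n G) → Fin k) → Set
IsCompleteArborealColoring G k c =
  Surjective _≡_ _≡_ c
  × (∀ i → InducesForest G (λ v → c v ≡ i))
  × (∀ i j → i ≢ j → HasCycleIn G (λ v → c v ≡ i ⊎ c v ≡ j))

IsAva : Graph → ℕ → Set
IsAva G a =
  (Σ (Fin (n G) → Fin a) λ c → IsCompleteArborealColoring G a c)
  × (∀ k (c : Fin (n G) → Fin k) → IsCompleteArborealColoring G k c → k ≤ a)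

-- Subdividing the edge uv of G: add a new vertex (index zero), adjacent
-- exactly to u and v, and delete the edge uv.
subdivide : (G : Graph) → Fin (n G) → Fin (n G) → Graph
subdivide G u v = mkGraph (suc (n G)) a
  where
  eq : Fin (n G) → Fin (n G) → Bool
  eq i j = ⌊ i ≟ j ⌋
  a : Fin (suc (n G)) → Fin (suc (n G)) → Bool
  a zero    zero    = false
  a zero    (suc j) = eq j u ∨ eq j v
  a (suc i) zero    = eq i u ∨ eq i v
  a (suc i) (suc j) =
    adj G i j ∧ not ((eq i u ∧ eq j v) ∨ (eq i v ∧ eq j u))

data IsSubdivisionOf (H : Graph) : Graph → Set where
  base : IsSubdivisionOf H H
  step : ∀ {S} → IsSubdivisionOf H S → (u v : Fin (n S)) →
         adj S u v ≡ true → IsSubdivisionOf H (subdivide S u v)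

InducedSubgraphOf : Graph → Graph → Set
InducedSubgraphOf S G =
  Σ (Fin (n S) → Fin (n G)) λ φ →
    Injective _≡_ _≡_ φ × (∀ a b → adj S a b ≡ adj G (φ a) (φ b))

ContainsInducedSubdivision : Graph → Graph → Set
ContainsInducedSubdivision G H =
  Σ Graph λ S → IsSubdivisionOf H S × InducedSubgraphOf S G

module Submission where

-- A complete arboreal coloring of H survives each edge subdivision with the
-- same number of colors: the new vertex w on uv takes the color of u, a
-- monochromatic cycle through w shortcuts via the edge uv to a cycle of the
-- old graph, and a bichromatic cycle using uv detours through w.  Inside G,
-- keep these colors on the induced copy of the subdivision and give every
-- other vertex a fresh color of its own: all classes are forests and the
-- ava(H) old classes are pairwise cyclic.  Merging two classes whose union
-- is a forest preserves this, and once no such pair is left the coloring is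
-- complete with at least ava(H) colors.  Whether a pair can still be merged
-- is not decided constructively, so the merging runs in the double-negation
-- monad; this suffices because ava(H) ≤ ava(G) is decidable.

open import Data.Bool using (true; _∧_; _∨_; not)
open import Data.Bool.Properties using (∧-comm; ∨-comm)
open import Data.Empty using (⊥; ⊥-elim)
open import Data.Fin using (Fin; zero; suc; inject₁; fromℕ; toℕ; _≟_; punchIn; punchOut; _↑ˡ_; _↑ʳ_; splitAt)
open import Data.Fin.Properties
  using ( suc-injective; inject₁-injective; fromℕ≢inject₁; toℕ-inject₁; any?; ¬Fin0; injective⇒≤
        ; punchInᵢ≢i; punchOut-injective; punchOut-cong; punchIn-punchOut; punchOut-punchIn
        ; ↑ˡ-injective; ↑ʳ-injective; splitAt-↑ˡ; splitAt-↑ʳ; splitAt⁻¹-↑ˡ; splitAt⁻¹-↑ʳ )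
open import Data.Fin.Relation.Unary.Top using (View; view; ‵fromℕ; ‵inject₁; view-fromℕ; view-inject₁)
open import Data.Nat using (ℕ; zero; suc; _+_; _≤_; z≤n; _≤?_)
import Data.Nat.Properties as ℕ
open import Data.Product using (Σ; ∃; _×_; _,_; proj₁; proj₂)
open import Data.Sum as Sum using (_⊎_; inj₁; inj₂; [_,_])
open import Defs
open import Function using (_∘_; id)
open import Function.Definitions using (Injective; Surjective)
open import Relation.Binary.PropositionalEquality hiding ([_])
open import Relation.Nullary using (¬_; Dec; yes; no; does; _×-dec_; _⊎-dec_; ¬¬-excluded-middle)
open import Relation.Nullary.Decidable using (isYes; isYes≗does; dec-false; decidable-stable)

csuc : ∀ {m} → Fin (suc m) → Fin (suc m)
csuc i = next (view i)
  where
  next : ∀ {m} {i : Fin (suc m)} → View i → Fin (suc m)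
  next ‵fromℕ       = zero
  next (‵inject₁ j) = suc j

csuc-fromℕ : ∀ m → csuc (fromℕ m) ≡ zero
csuc-fromℕ m rewrite view-fromℕ m = refl

csuc-inject₁ : ∀ {m} (i : Fin m) → csuc (inject₁ i) ≡ suc i
csuc-inject₁ i rewrite view-inject₁ i = refl

cpred : ∀ {m} → Fin (suc m) → Fin (suc m)
cpred zero    = fromℕ _
cpred (suc i) = inject₁ i

cpred-csuc : ∀ {m} (i : Fin (suc m)) → cpred (csuc i) ≡ i
cpred-csuc i with view i
... | ‵fromℕ     = refl
... | ‵inject₁ _ = refl

csuc-injective : ∀ {m} → Injective _≡_ _≡_ (csuc {m})
csuc-injective {x = i} {j} eq = begin
  i              ≡⟨ cpred-csuc i ⟨
  cpred (csuc i) ≡⟨ cong cpred eq ⟩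
  cpred (csuc j) ≡⟨ cpred-csuc j ⟩
  j              ∎
  where open ≡-Reasoning

csuc^ : ∀ {m} → ℕ → Fin (suc m) → Fin (suc m)
csuc^ zero    i = i
csuc^ (suc r) i = csuc (csuc^ r i)

csuc^-csuc : ∀ {m} r (i : Fin (suc m)) → csuc^ r (csuc i) ≡ csuc^ (suc r) i
csuc^-csuc zero    i = refl
csuc^-csuc (suc r) i = cong csuc (csuc^-csuc r i)

csuc^-injective : ∀ {m} r → Injective _≡_ _≡_ (csuc^ {m} r)
csuc^-injective zero    eq = eq
csuc^-injective (suc r) eq = csuc^-injective r (csuc-injective eq)

csuc^-zero : ∀ {m} r (j : Fin (suc m)) → toℕ j ≡ r → csuc^ r zero ≡ j
csuc^-zero zero    zero    _  = refl
csuc^-zero (suc r) (suc j) eq = begin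
  csuc (csuc^ r zero) ≡⟨ cong csuc (csuc^-zero r (inject₁ j) toℕ-j≡r) ⟩
  csuc (inject₁ j)    ≡⟨ csuc-inject₁ j ⟩
  suc j               ∎
  where
  open ≡-Reasoning
  toℕ-j≡r = trans (toℕ-inject₁ j) (ℕ.suc-injective eq)

csuc^-fromℕ : ∀ {m} (j : Fin (suc m)) → csuc^ (suc (toℕ j)) (fromℕ m) ≡ j
csuc^-fromℕ {m} j = begin
  csuc^ (suc (toℕ j)) (fromℕ m) ≡⟨ csuc^-csuc (toℕ j) (fromℕ m) ⟨
  csuc^ (toℕ j) (csuc (fromℕ m)) ≡⟨ cong (csuc^ (toℕ j)) (csuc-fromℕ m) ⟩
  csuc^ (toℕ j) zero             ≡⟨ csuc^-zero (toℕ j) j refl ⟩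
  j                              ∎
  where open ≡-Reasoning

infixl 5 _∷ʳ_

_∷ʳ_ : ∀ {A : Set} {m} → (Fin m → A) → A → Fin (suc m) → A
_∷ʳ_ {A} {m} w x i = extend (view i)
  where
  extend : {i : Fin (suc m)} → View i → A
  extend ‵fromℕ       = x
  extend (‵inject₁ j) = w j

∷ʳ-fromℕ : ∀ {A : Set} {m} (w : Fin m → A) x → (w ∷ʳ x) (fromℕ m) ≡ x
∷ʳ-fromℕ {m = m} w x rewrite view-fromℕ m = refl

∷ʳ-inject₁ : ∀ {A : Set} {m} (w : Fin m → A) x i → (w ∷ʳ x) (inject₁ i) ≡ w i
∷ʳ-inject₁ w x i rewrite view-inject₁ i = refl

∷ʳ-injective : ∀ {A : Set} {m} {w : Fin m → A} {x} →
               Injective _≡_ _≡_ w → (∀ i → w i ≢ x) → Injective _≡_ _≡_ (w ∷ʳ x)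
∷ʳ-injective w-inj x∉w {i} {j} eq with view i | view j
... | ‵fromℕ     | ‵fromℕ     = refl
... | ‵fromℕ     | ‵inject₁ j = ⊥-elim (x∉w j (sym eq))
... | ‵inject₁ i | ‵fromℕ     = ⊥-elim (x∉w i eq)
... | ‵inject₁ i | ‵inject₁ j = cong inject₁ (w-inj eq)

Adj : (G : Graph) → Fin (n G) → Fin (n G) → Set
Adj G x y = adj G x y ≡ true

-- A cycle presented with a cyclic successor, so that it can be rotated;
-- HasCycleIn presents the same data as a path plus a closing edge.
record Cycle (G : Graph) (P : Fin (n G) → Set) : Set where
  constructor mkCycle
  field
    len       : ℕ
    vertex    : Fin (3 + len) → Fin (n G)
    injective : Injective _≡_ _≡_ vertex
    inside    : ∀ i → P (vertex i)
    adjacent  : ∀ i → Adj G (vertex i) (vertex (csuc i))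

  last : Fin (n G)
  last = vertex (fromℕ (2 + len))

  pathAdjacent : ∀ (i : Fin (2 + len)) → Adj G (vertex (inject₁ i)) (vertex (suc i))
  pathAdjacent i =
    subst (Adj G (vertex (inject₁ i)) ∘ vertex) (csuc-inject₁ i) (adjacent (inject₁ i))

  closing : Adj G last (vertex zero)
  closing = subst (Adj G last ∘ vertex) (csuc-fromℕ (2 + len)) (adjacent (fromℕ (2 + len)))

module _ {G : Graph} {P : Fin (n G) → Set} where

  hasCycle⇒cycle : HasCycleIn G P → Cycle G P
  hasCycle⇒cycle (k , w , w-inj , w∈P , path , close) = mkCycle k w w-inj w∈P adjacent
    where
    adjacent : ∀ i → Adj G (w i) (w (csuc i))
    adjacent i with view i
    ... | ‵fromℕ     = close
    ... | ‵inject₁ j = path j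

  cycle⇒hasCycle : Cycle G P → HasCycleIn G P
  cycle⇒hasCycle C = len , vertex , injective , inside , pathAdjacent , closing
    where open Cycle C

  rotate : (C : Cycle G P) → Fin (3 + Cycle.len C) → Cycle G P
  rotate C j = mkCycle len (vertex ∘ σ) (λ eq → csuc^-injective r (injective eq)) (inside ∘ σ)
                       adjacent′
    where
    open Cycle C
    r = suc (toℕ j)
    σ = csuc^ r
    adjacent′ : ∀ i → Adj G (vertex (σ i)) (vertex (σ (csuc i)))
    adjacent′ i = subst (Adj G (vertex (σ i)) ∘ vertex) (sym (csuc^-csuc r i)) (adjacent (σ i))

  rotate-last : ∀ C j → Cycle.last (rotate C j) ≡ Cycle.vertex C j
  rotate-last C j = cong (Cycle.vertex C) (csuc^-fromℕ j)

  rotate-zero : ∀ C j → Cycle.vertex (rotate C j) zero ≡ Cycle.vertex C (csuc j)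
  rotate-zero C j = cong (Cycle.vertex C ∘ csuc) (csuc^-zero (toℕ j) j refl)

hasCycle-map : ∀ {G H} {P : Fin (n G) → Set} {Q : Fin (n H) → Set}
  (f : ∀ x → P x → Fin (n H)) →
  (∀ x y (p : P x) (q : P y) → f x p ≡ f y q → x ≡ y) →
  (∀ x (p : P x) → Q (f x p)) →
  (∀ x y (p : P x) (q : P y) → Adj G x y → Adj H (f x p) (f y q)) →
  HasCycleIn G P → HasCycleIn H Q
hasCycle-map f f-inj f∈Q f-adj (k , w , w-inj , w∈P , path , close) =
  k , (λ i → f (w i) (w∈P i)) , (λ eq → w-inj (f-inj _ _ _ _ eq)) , (λ i → f∈Q (w i) (w∈P i)) ,
  (λ i → f-adj _ _ _ _ (path i)) , f-adj _ _ _ _ close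

hasCycle-mono : ∀ {G} {P Q : Fin (n G) → Set} → (∀ x → P x → Q x) → HasCycleIn G P → HasCycleIn G Q
hasCycle-mono P⊆Q (k , w , w-inj , w∈P , path , close) =
  k , w , w-inj , (λ i → P⊆Q (w i) (w∈P i)) , path , close

forest-of-subsingleton : ∀ {G} {P : Fin (n G) → Set} y → (∀ x → P x → x ≡ y) → InducesForest G P
forest-of-subsingleton y P⊆y (k , w , w-inj , w∈P , _)
  with w-inj {zero} {suc zero} (trans (P⊆y _ (w∈P zero)) (sym (P⊆y _ (w∈P (suc zero)))))
... | ()

IsSymmetric : Graph → Set
IsSymmetric G = ∀ x y → adj G x y ≡ adj G y x

-- In subdivide S u v the new vertex is zero and the old vertex x is suc x.
module Subdivision (S : Graph) (S-sym : IsSymmetric S) {u v : Fin (n S)} (uv : Adj S u v) where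

  S′ : Graph
  S′ = subdivide S u v

  IsUV : Fin (n S) → Fin (n S) → Set
  IsUV x y = (x ≡ u × y ≡ v) ⊎ (x ≡ v × y ≡ u)

  isUV? : ∀ x y → Dec (IsUV x y)
  isUV? x y = (x ≟ u ×-dec y ≟ v) ⊎-dec (x ≟ v ×-dec y ≟ u)

  IsUV-swap : ∀ {x y} → IsUV x y → IsUV y x
  IsUV-swap (inj₁ (x≡u , y≡v)) = inj₂ (y≡v , x≡u)
  IsUV-swap (inj₂ (x≡v , y≡u)) = inj₁ (y≡u , x≡v)

  IsUV-unique : ∀ {x y x′ y′} → IsUV x y → IsUV x′ y′ →
                (x ≡ x′ × y ≡ y′) ⊎ (x ≡ y′ × y ≡ x′)
  IsUV-unique (inj₁ (refl , refl)) (inj₁ (refl , refl)) = inj₁ (refl , refl)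
  IsUV-unique (inj₁ (refl , refl)) (inj₂ (refl , refl)) = inj₂ (refl , refl)
  IsUV-unique (inj₂ (refl , refl)) (inj₁ (refl , refl)) = inj₂ (refl , refl)
  IsUV-unique (inj₂ (refl , refl)) (inj₂ (refl , refl)) = inj₁ (refl , refl)

  IsUV-fst : ∀ {x y} → IsUV x y → x ≡ u ⊎ x ≡ v
  IsUV-fst (inj₁ (x≡u , _)) = inj₁ x≡u
  IsUV-fst (inj₂ (x≡v , _)) = inj₂ x≡v

  IsUV-snd : ∀ {x y} → IsUV x y → y ≡ u ⊎ y ≡ v
  IsUV-snd = IsUV-fst ∘ IsUV-swap

  IsUV-∋u : ∀ {x y} → IsUV x y → x ≡ u ⊎ y ≡ u
  IsUV-∋u (inj₁ (x≡u , _)) = inj₁ x≡u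
  IsUV-∋u (inj₂ (_ , y≡u)) = inj₂ y≡u

  IsUV-from-ends : ∀ {x y} → x ≡ u ⊎ x ≡ v → y ≡ u ⊎ y ≡ v → x ≢ y → IsUV x y
  IsUV-from-ends (inj₁ x≡u) (inj₁ y≡u) x≢y = ⊥-elim (x≢y (trans x≡u (sym y≡u)))
  IsUV-from-ends (inj₁ x≡u) (inj₂ y≡v) _   = inj₁ (x≡u , y≡v)
  IsUV-from-ends (inj₂ x≡v) (inj₁ y≡u) _   = inj₂ (x≡v , y≡u)
  IsUV-from-ends (inj₂ x≡v) (inj₂ y≡v) x≢y = ⊥-elim (x≢y (trans x≡v (sym y≡v)))

  IsUV⇒Adj : ∀ {x y} → IsUV x y → Adj S x y
  IsUV⇒Adj (inj₁ (refl , refl)) = uv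
  IsUV⇒Adj (inj₂ (refl , refl)) = trans (S-sym v u) uv

  old-adj : ∀ x y → adj S′ (suc x) (suc y) ≡ adj S x y ∧ not (does (isUV? x y))
  old-adj x y = cong (λ b → adj S x y ∧ not b)
    (cong₂ _∨_ (cong₂ _∧_ (isYes≗does (x ≟ u)) (isYes≗does (y ≟ v)))
               (cong₂ _∧_ (isYes≗does (x ≟ v)) (isYes≗does (y ≟ u))))

  old-edge⁺ : ∀ {x y} → Adj S x y → ¬ IsUV x y → Adj S′ (suc x) (suc y)
  old-edge⁺ {x} {y} e ¬uv rewrite old-adj x y | e | dec-false (isUV? x y) ¬uv = refl

  old-edge⁻ : ∀ {x y} → Adj S′ (suc x) (suc y) → Adj S x y × ¬ IsUV x y
  old-edge⁻ {x} {y} e = split (adj S x y) (isUV? x y) (trans (sym (old-adj x y)) e)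
    where
    split : ∀ b (d : Dec (IsUV x y)) → b ∧ not (does d) ≡ true → b ≡ true × ¬ IsUV x y
    split true (no ¬uv) _ = refl , ¬uv

  -- adj S′ zero (suc x) and adj S′ (suc x) zero are the same Boolean,
  -- so these also serve for edges into the new vertex.
  new-edge⁺ : ∀ {x} → x ≡ u ⊎ x ≡ v → Adj S′ zero (suc x)
  new-edge⁺ {x} x∈uv with x ≟ u | x ≟ v
  ... | yes _ | _     = refl
  ... | no _  | yes _ = refl
  ... | no x≢u | no x≢v = ⊥-elim ([ x≢u , x≢v ] x∈uv)

  new-edge⁻ : ∀ {x} → Adj S′ zero (suc x) → x ≡ u ⊎ x ≡ v
  new-edge⁻ {x} e with x ≟ u | x ≟ v
  ... | yes x≡u | _       = inj₁ x≡u
  ... | no _    | yes x≡v = inj₂ x≡v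

  subdivide-symmetric : IsSymmetric S′
  subdivide-symmetric zero    zero    = refl
  subdivide-symmetric zero    (suc y) = refl
  subdivide-symmetric (suc x) zero    = refl
  subdivide-symmetric (suc x) (suc y) = cong₂ (λ a b → a ∧ not b) (S-sym x y)
    (trans (∨-comm (x≟u ∧ y≟v) (x≟v ∧ y≟u)) (cong₂ _∨_ (∧-comm x≟v y≟u) (∧-comm x≟u y≟v)))
    where
    x≟u = isYes (x ≟ u)
    x≟v = isYes (x ≟ v)
    y≟u = isYes (y ≟ u)
    y≟v = isYes (y ≟ v)

  module _ {P : Fin (n S) → Set} {P′ : Fin (n S′) → Set} where

    raise-cycle : (∀ x → P x → P′ (suc x)) → (C : Cycle S P) →
                  (∀ i → ¬ IsUV (Cycle.vertex C i) (Cycle.vertex C (csuc i))) → Cycle S′ P′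
    raise-cycle P⇒P′ C avoids-uv = mkCycle len (suc ∘ vertex) (λ eq → injective (suc-injective eq))
      (λ i → P⇒P′ _ (inside i)) (λ i → old-edge⁺ (adjacent i) (avoids-uv i))
      where open Cycle C

    lower-cycle : (∀ x → P′ (suc x) → P x) → (C : Cycle S′ P′) →
                  (∀ i → zero ≢ Cycle.vertex C i) → Cycle S P
    lower-cycle P′⇒P C avoids-new = mkCycle len w′ w′-injective
      (λ i → P′⇒P _ (subst P′ (sym (raise i)) (inside i)))
      (λ i → proj₁ (old-edge⁻ (subst₂ (Adj S′) (sym (raise i)) (sym (raise (csuc i))) (adjacent i))))
      where
      open Cycle C
      w′ : Fin (3 + len) → Fin (n S)
      w′ i = punchOut (avoids-new i)
      raise : ∀ i → suc (w′ i) ≡ vertex i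
      raise i = punchIn-punchOut (avoids-new i)
      w′-injective : Injective _≡_ _≡_ w′
      w′-injective eq = injective (punchOut-injective (avoids-new _) (avoids-new _) eq)

    -- The condition ¬ IsUV on the steps only serves to rule out the path u v itself.
    close-path : ∀ k (w : Fin (2 + k) → Fin (n S)) → Injective _≡_ _≡_ w → (∀ i → P (w i)) →
                 (∀ (i : Fin (1 + k)) → Adj S (w (inject₁ i)) (w (suc i))
                                       × ¬ IsUV (w (inject₁ i)) (w (suc i))) →
                 IsUV (w (fromℕ (1 + k))) (w zero) → HasCycleIn S P
    close-path zero    w _     _   path ends = ⊥-elim (proj₂ (path zero) (IsUV-swap ends))
    close-path (suc k) w w-inj w∈P path ends = k , w , w-inj , w∈P , proj₁ ∘ path , IsUV⇒Adj ends

    contract-at-last : (∀ x → P′ (suc x) → P x) → (C : Cycle S′ P′) →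
                       Cycle.last C ≡ zero → HasCycleIn S P
    contract-at-last P′⇒P C last≡0 = close-path len w′ w′-injective
      (λ i → P′⇒P _ (subst P′ (sym (raise i)) (inside (inject₁ i))))
      (λ i → old-edge⁻ (subst₂ (Adj S′) (sym (raise (inject₁ i))) (sym (raise (suc i)))
                                        (pathAdjacent (inject₁ i))))
      (IsUV-from-ends (new-edge⁻ into-last) (new-edge⁻ out-of-last) (ends-distinct ∘ w′-injective))
      where
      open Cycle C
      not-new : ∀ (i : Fin (2 + len)) → zero ≢ vertex (inject₁ i)
      not-new i 0≡w = fromℕ≢inject₁ (injective (trans last≡0 0≡w))
      w′ : Fin (2 + len) → Fin (n S)
      w′ i = punchOut (not-new i)
      raise : ∀ i → suc (w′ i) ≡ vertex (inject₁ i)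
      raise i = punchIn-punchOut (not-new i)
      w′-injective : Injective _≡_ _≡_ w′
      w′-injective eq = inject₁-injective (injective (punchOut-injective (not-new _) (not-new _) eq))
      into-last : Adj S′ (suc (w′ (fromℕ (1 + len)))) zero
      into-last = subst₂ (Adj S′) (sym (raise (fromℕ (1 + len)))) last≡0 (pathAdjacent (fromℕ (1 + len)))
      out-of-last : Adj S′ zero (suc (w′ zero))
      out-of-last = subst₂ (Adj S′) last≡0 (sym (raise zero)) closing
      ends-distinct : fromℕ (1 + len) ≢ zero
      ends-distinct ()

    expand-at-last : (∀ x → P x → P′ (suc x)) → (P u → P′ zero) → (C : Cycle S P) →
                     IsUV (Cycle.last C) (Cycle.vertex C zero) → HasCycleIn S′ P′
    expand-at-last P⇒P′ Pu⇒P′0 C ends = suc len , w′ , w′-injective , w′∈P′ , path , closing′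
      where
      open Cycle C
      raised : Fin (3 + len) → Fin (n S′)
      raised = suc ∘ vertex
      w′ : Fin (4 + len) → Fin (n S′)
      w′ = raised ∷ʳ zero
      w′-injective : Injective _≡_ _≡_ w′
      w′-injective = ∷ʳ-injective (λ eq → injective (suc-injective eq)) (λ _ ())
      u∈C : P u
      u∈C = [ (λ last≡u → subst P last≡u (inside (fromℕ (2 + len))))
            , (λ first≡u → subst P first≡u (inside zero)) ] (IsUV-∋u ends)
      w′∈P′ : ∀ i → P′ (w′ i)
      w′∈P′ i with view i
      ... | ‵fromℕ     = Pu⇒P′0 u∈C
      ... | ‵inject₁ j = P⇒P′ _ (inside j)
      -- Only the closing step of C joins u and v, as C is injective.
      path-avoids-uv : ∀ (j : Fin (2 + len)) → ¬ IsUV (vertex (inject₁ j)) (vertex (suc j))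
      path-avoids-uv j uv-j with IsUV-unique uv-j ends
      ... | inj₁ (j≡last , _) = fromℕ≢inject₁ (sym (injective j≡last))
      ... | inj₂ (j≡first , sj≡last) with suc-injective (injective sj≡last)
      ...   | refl with injective j≡first
      ...     | ()
      path : ∀ (i : Fin (3 + len)) → Adj S′ (w′ (inject₁ i)) (w′ (suc i))
      path i = path-at (view i)
        where
        path-at : ∀ {i} → View i → Adj S′ (w′ (inject₁ i)) (w′ (suc i))
        path-at ‵fromℕ = subst₂ (Adj S′)
          (sym (∷ʳ-inject₁ raised zero (fromℕ (2 + len)))) (sym (∷ʳ-fromℕ raised zero))
          (new-edge⁺ (IsUV-fst ends))
        path-at (‵inject₁ j) = subst₂ (Adj S′)
          (sym (∷ʳ-inject₁ raised zero (inject₁ j))) (sym (∷ʳ-inject₁ raised zero (suc j)))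
          (old-edge⁺ (pathAdjacent j) (path-avoids-uv j))
      closing′ : Adj S′ (w′ (fromℕ (3 + len))) (w′ zero)
      closing′ = subst (λ x → Adj S′ x (w′ zero)) (sym (∷ʳ-fromℕ raised zero))
                       (new-edge⁺ (IsUV-snd ends))

    cycle-contract : (∀ x → P′ (suc x) → P x) → Cycle S′ P′ → HasCycleIn S P
    cycle-contract P′⇒P C with any? (λ i → Cycle.vertex C i ≟ zero)
    ... | no avoids-new  = cycle⇒hasCycle (lower-cycle P′⇒P C (λ i 0≡w → avoids-new (i , sym 0≡w)))
    ... | yes (j , w≡0) = contract-at-last P′⇒P (rotate C j) (trans (rotate-last C j) w≡0)

    cycle-expand : (∀ x → P x → P′ (suc x)) → (P u → P′ zero) → Cycle S P → HasCycleIn S′ P′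
    cycle-expand P⇒P′ Pu⇒P′0 C with any? (λ i → isUV? (Cycle.vertex C i) (Cycle.vertex C (csuc i)))
    ... | no avoids-uv = cycle⇒hasCycle (raise-cycle P⇒P′ C (λ i uv-i → avoids-uv (i , uv-i)))
    ... | yes (j , uv-j) = expand-at-last P⇒P′ Pu⇒P′0 (rotate C j)
                             (subst₂ IsUV (sym (rotate-last C j)) (sym (rotate-zero C j)) uv-j)

  subdivide-coloring : ∀ {k} → (Fin (n S) → Fin k) → Fin (n S′) → Fin k
  subdivide-coloring c zero    = c u
  subdivide-coloring c (suc x) = c x

  subdivide-complete : ∀ {k} {c : Fin (n S) → Fin k} → IsCompleteArborealColoring S k c →
                       IsCompleteArborealColoring S′ k (subdivide-coloring c)
  subdivide-complete {c = c} (surjective , forests , cyclic) =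
    (λ t → suc (proj₁ (surjective t)) , λ { refl → proj₂ (surjective t) refl }) ,
    (λ t → forests t ∘ cycle-contract {P′ = λ x → c′ x ≡ t} (λ _ → id) ∘ hasCycle⇒cycle) ,
    (λ p q p≢q → cycle-expand {P′ = λ x → c′ x ≡ p ⊎ c′ x ≡ q} (λ _ → id) id
                              (hasCycle⇒cycle (cyclic p q p≢q)))
    where c′ = subdivide-coloring c

subdivision-complete : ∀ {H S k} {c : Fin (n H) → Fin k} →
  IsSubdivisionOf H S → IsSymmetric H → IsCompleteArborealColoring H k c →
  IsSymmetric S × Σ (Fin (n S) → Fin k) (IsCompleteArborealColoring S k)
subdivision-complete base H-sym complete = H-sym , _ , complete
subdivision-complete (step sub u v uv) H-sym complete with subdivision-complete sub H-sym complete
... | S-sym , c , c-complete =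
  subdivide-symmetric , subdivide-coloring c , subdivide-complete c-complete
  where open Subdivision _ S-sym uv

AvaAtLeast : Graph → ℕ → Set
AvaAtLeast G b = Σ ℕ λ k → Σ (Fin (n G) → Fin k) λ c → IsCompleteArborealColoring G k c × b ≤ k

¬¬-∀-Fin : ∀ {m} {Q : Fin m → Set} → (∀ i → ¬ ¬ Q i) → ¬ ¬ (∀ i → Q i)
¬¬-∀-Fin {zero}  _   ¬∀Q = ¬∀Q λ ()
¬¬-∀-Fin {suc m} ¬¬Q ¬∀Q = ¬¬Q zero λ Q0 → ¬¬-∀-Fin (¬¬Q ∘ suc) λ Qs → ¬∀Q λ where
  zero    → Q0
  (suc i) → Qs i

module _ (G : Graph) where

  record ArborealWithCore (b : ℕ) {m} (c : Fin (n G) → Fin m) : Set where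
    field
      forests        : ∀ i → InducesForest G (λ v → c v ≡ i)
      core           : Fin b → Fin m
      core-injective : Injective _≡_ _≡_ core
      core-nonempty  : ∀ p → ∃ λ v → c v ≡ core p
      core-cyclic    : ∀ p q → p ≢ q → HasCycleIn G (λ v → c v ≡ core p ⊎ c v ≡ core q)

  complete⇒surjective : ∀ {m} {c : Fin (n G) → Fin m} → Fin (n G) →
    (∀ i → InducesForest G (λ v → c v ≡ i)) →
    (∀ i j → i ≢ j → HasCycleIn G (λ v → c v ≡ i ⊎ c v ≡ j)) → Surjective _≡_ _≡_ c
  complete⇒surjective {c = c} v₀ forests cyclic t with any? (λ v → c v ≟ t)
  ... | yes (v , cv≡t) = v , λ { refl → cv≡t }
  ... | no ¬∃v = ⊥-elim (forests (c v₀) (hasCycle-mono {G = G} only-c-v₀ (cyclic t (c v₀) t≢cv₀)))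
    where
    t≢cv₀ : t ≢ c v₀
    t≢cv₀ t≡cv₀ = ¬∃v (v₀ , sym t≡cv₀)
    only-c-v₀ : ∀ v → c v ≡ t ⊎ c v ≡ c v₀ → c v ≡ c v₀
    only-c-v₀ v (inj₁ cv≡t)   = ⊥-elim (¬∃v (v , cv≡t))
    only-c-v₀ _ (inj₂ cv≡cv₀) = cv≡cv₀

  module Merge {m} {i j : Fin (suc m)} (i≢j : i ≢ j) where

    IsIJ : Fin (suc m) → Set
    IsIJ x = x ≡ i ⊎ x ≡ j

    merge : Fin (suc m) → Fin m
    merge x with x ≟ j
    ... | yes _   = punchOut (i≢j ∘ sym)
    ... | no x≢j = punchOut (x≢j ∘ sym)

    merge-fibre : ∀ x y → merge x ≡ merge y → x ≡ y ⊎ (IsIJ x × IsIJ y)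
    merge-fibre x y eq with x ≟ j | y ≟ j
    ... | yes x≡j | yes y≡j = inj₁ (trans x≡j (sym y≡j))
    ... | yes x≡j | no y≢j  = inj₂ (inj₂ x≡j , inj₁ (sym (punchOut-injective (i≢j ∘ sym) (y≢j ∘ sym) eq)))
    ... | no x≢j  | yes y≡j = inj₂ (inj₁ (punchOut-injective (x≢j ∘ sym) (i≢j ∘ sym) eq) , inj₂ y≡j)
    ... | no x≢j  | no y≢j  = inj₁ (punchOut-injective (x≢j ∘ sym) (y≢j ∘ sym) eq)

    merge-punchIn : ∀ t → merge (punchIn j t) ≡ t
    merge-punchIn t with punchIn j t ≟ j
    ... | yes jt≡j = ⊥-elim (punchInᵢ≢i j t jt≡j)
    ... | no _     = trans (punchOut-cong j refl) (punchOut-punchIn j)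

    isIJ? : ∀ x → Dec (IsIJ x)
    isIJ? x = x ≟ i ⊎-dec x ≟ j

    merge-forests : ∀ {c : Fin (n G) → Fin (suc m)} →
      (∀ s → InducesForest G (λ v → c v ≡ s)) → InducesForest G (λ v → c v ≡ i ⊎ c v ≡ j) →
      ∀ t → InducesForest G (λ v → merge (c v) ≡ t)
    merge-forests {c} forests ij-forest t cycle with isIJ? (punchIn j t)
    ... | yes ij = ij-forest (hasCycle-mono {G = G} into-ij cycle)
      where
      into-ij : ∀ v → merge (c v) ≡ t → IsIJ (c v)
      into-ij v eq with merge-fibre (c v) (punchIn j t) (trans eq (sym (merge-punchIn t)))
      ... | inj₁ cv≡s        = subst IsIJ (sym cv≡s) ij
      ... | inj₂ (ij-cv , _) = ij-cv
    ... | no ¬ij = forests (punchIn j t) (hasCycle-mono {G = G} into-s cycle)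
      where
      into-s : ∀ v → merge (c v) ≡ t → c v ≡ punchIn j t
      into-s v eq with merge-fibre (c v) (punchIn j t) (trans eq (sym (merge-punchIn t)))
      ... | inj₁ cv≡s       = cv≡s
      ... | inj₂ (_ , ij-s) = ⊥-elim (¬ij ij-s)

    merge-core : ∀ {b} {c : Fin (n G) → Fin (suc m)} → ArborealWithCore b c →
      InducesForest G (λ v → c v ≡ i ⊎ c v ≡ j) → ArborealWithCore b (merge ∘ c)
    merge-core {b} {c} A ij-forest = record
      { forests        = merge-forests {c} forests ij-forest
      ; core           = merge ∘ core
      ; core-injective = merged-core-injective
      ; core-nonempty  = λ p → proj₁ (core-nonempty p) , cong merge (proj₂ (core-nonempty p))
      ; core-cyclic    = λ p q p≢q →
          hasCycle-mono {G = G} (λ v → Sum.map (cong merge {c v}) (cong merge {c v})) (core-cyclic p q p≢q)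
      }
      where
      open ArborealWithCore A
      -- Two distinct core classes together contain a cycle, so they cannot be the merged pair.
      merged-core-injective : Injective _≡_ _≡_ (merge ∘ core)
      merged-core-injective {p} {q} eq with merge-fibre (core p) (core q) eq | p ≟ q
      ... | inj₁ cp≡cq        | _       = core-injective cp≡cq
      ... | inj₂ _            | yes p≡q = p≡q
      ... | inj₂ (ij-p , ij-q) | no p≢q =
        ⊥-elim (ij-forest (hasCycle-mono {G = G} into-ij (core-cyclic p q p≢q)))
        where
        into-ij : ∀ v → c v ≡ core p ⊎ c v ≡ core q → IsIJ (c v)
        into-ij v (inj₁ cv≡cp) = subst IsIJ (sym cv≡cp) ij-p
        into-ij v (inj₂ cv≡cq) = subst IsIJ (sym cv≡cq) ij-q

  greedy : ∀ {b m} (c : Fin (n G) → Fin m) → ArborealWithCore (suc b) c → ¬ ¬ AvaAtLeast G (suc b)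
  greedy {m = zero} c A = ⊥-elim (¬Fin0 (ArborealWithCore.core A zero))
  greedy {b} {suc m} c A ¬ava = ¬¬-excluded-middle merge-or-stop
    where
    open ArborealWithCore A
    v₀ = proj₁ (core-nonempty zero)
    Mergeable : Set
    Mergeable = ∃ λ i → ∃ λ j → i ≢ j × InducesForest G (λ v → c v ≡ i ⊎ c v ≡ j)
    all-cyclic : ¬ Mergeable → ∀ i j → ¬ ¬ (i ≢ j → HasCycleIn G (λ v → c v ≡ i ⊎ c v ≡ j))
    all-cyclic unmergeable i j ¬cyclic =
      unmergeable (i , j , (λ i≡j → ¬cyclic (λ i≢j → ⊥-elim (i≢j i≡j))) , (λ cycle → ¬cyclic λ _ → cycle))
    merge-or-stop : Dec Mergeable → ⊥
    merge-or-stop (yes (i , j , i≢j , ij-forest)) =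
      greedy (Merge.merge i≢j ∘ c) (Merge.merge-core i≢j A ij-forest) ¬ava
    merge-or-stop (no unmergeable) =
      ¬¬-∀-Fin (λ i → ¬¬-∀-Fin (all-cyclic unmergeable i)) λ cyclic →
        ¬ava (suc m , c , (complete⇒surjective v₀ forests cyclic , forests , cyclic) ,
              injective⇒≤ core-injective)

module InducedSubgraph {S G : Graph} (embedding : InducedSubgraphOf S G) where

  φ : Fin (n S) → Fin (n G)
  φ = proj₁ embedding

  φ-injective : Injective _≡_ _≡_ φ
  φ-injective = proj₁ (proj₂ embedding)

  φ-adj : ∀ s s′ → adj S s s′ ≡ adj G (φ s) (φ s′)
  φ-adj = proj₂ (proj₂ embedding)

  push-cycle : ∀ {P Q} → (∀ s → P s → Q (φ s)) → HasCycleIn S P → HasCycleIn G Q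
  push-cycle {P} {Q} P⇒Q = hasCycle-map {G = S} {H = G} {P} {Q}
    (λ s _ → φ s) (λ _ _ _ _ → φ-injective) P⇒Q (λ _ _ _ _ e → trans (sym (φ-adj _ _)) e)

  pull-cycle : ∀ {P Q} → (∀ v → Q v → Σ (Fin (n S)) λ s → φ s ≡ v × P s) →
               HasCycleIn G Q → HasCycleIn S P
  pull-cycle {P} {Q} preimage = hasCycle-map {G = G} {H = S} {Q} {P} (λ v q → proj₁ (preimage v q))
    (λ x y p q eq → trans (sym (φ-pre x p)) (trans (cong φ eq) (φ-pre y q)))
    (λ v q → proj₂ (proj₂ (preimage v q)))
    (λ x y p q e → trans (φ-adj _ _) (subst₂ (Adj G) (sym (φ-pre x p)) (sym (φ-pre y q)) e))
    where
    φ-pre : ∀ v (q : Q v) → φ (proj₁ (preimage v q)) ≡ v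
    φ-pre v q = proj₁ (proj₂ (preimage v q))

  module _ {k} (c : Fin (n S) → Fin k) where

    extend-coloring : Fin (n G) → Fin (k + n G)
    extend-coloring v with any? (λ s → φ s ≟ v)
    ... | yes (s , _) = c s ↑ˡ n G
    ... | no _        = k ↑ʳ v

    ↑ˡ≢↑ʳ : ∀ x y → x ↑ˡ n G ≢ k ↑ʳ y
    ↑ˡ≢↑ʳ x y eq
      with trans (sym (splitAt-↑ˡ k x (n G))) (trans (cong (splitAt k) eq) (splitAt-↑ʳ k (n G) y))
    ... | ()

    extend-coloring-φ : ∀ s → extend-coloring (φ s) ≡ c s ↑ˡ n G
    extend-coloring-φ s with any? (λ s′ → φ s′ ≟ φ s)
    ... | yes (s′ , φs′≡φs) = cong (λ z → c z ↑ˡ n G) (φ-injective φs′≡φs)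
    ... | no ∄s′             = ⊥-elim (∄s′ (s , refl))

    extend-coloring-old : ∀ v x → extend-coloring v ≡ x ↑ˡ n G →
                          Σ (Fin (n S)) λ s → φ s ≡ v × c s ≡ x
    extend-coloring-old v x eq with any? (λ s → φ s ≟ v)
    ... | yes (s , φs≡v) = s , φs≡v , ↑ˡ-injective (n G) _ _ eq
    ... | no _           = ⊥-elim (↑ˡ≢↑ʳ x v (sym eq))

    extend-coloring-fresh : ∀ v y → extend-coloring v ≡ k ↑ʳ y → v ≡ y
    extend-coloring-fresh v y eq with any? (λ s → φ s ≟ v)
    ... | yes _ = ⊥-elim (↑ˡ≢↑ʳ _ y eq)
    ... | no _  = ↑ʳ-injective k v y eq

    extend-core : IsCompleteArborealColoring S k c → ArborealWithCore G k extend-coloring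
    extend-core (surjective , forests , cyclic) = record
      { forests        = extended-forests
      ; core           = _↑ˡ n G
      ; core-injective = ↑ˡ-injective (n G) _ _
      ; core-nonempty  = λ p → let (s , cs≡p) = surjective p in φ s , recolour p s (cs≡p refl)
      ; core-cyclic    = λ p q p≢q →
          push-cycle {Q = λ v → extend-coloring v ≡ p ↑ˡ n G ⊎ extend-coloring v ≡ q ↑ˡ n G}
                     (λ s → Sum.map (recolour p s) (recolour q s)) (cyclic p q p≢q)
      }
      where
      recolour : ∀ p s → c s ≡ p → extend-coloring (φ s) ≡ p ↑ˡ n G
      recolour p s cs≡p = trans (extend-coloring-φ s) (cong (_↑ˡ n G) cs≡p)
      extended-forests : ∀ t → InducesForest G (λ v → extend-coloring v ≡ t)
      extended-forests t with splitAt k t in split≡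
      ... | inj₁ x = forests x ∘ pull-cycle λ v cv≡t →
        extend-coloring-old v x (trans cv≡t (sym (splitAt⁻¹-↑ˡ split≡)))
      ... | inj₂ y = forest-of-subsingleton {G = G} y λ v cv≡t →
        extend-coloring-fresh v y (trans cv≡t (sym (splitAt⁻¹-↑ʳ split≡)))

corollary2p16 : (G H : Graph) → IsSimple G → IsSimple H →
                ContainsInducedSubdivision G H →
                (a b : ℕ) → IsAva G a → IsAva H b → b ≤ a
-- G need not be simple, and of the simplicity of H only symmetry is used.
corollary2p16 G H _ _ _ a zero _ _ = z≤n
corollary2p16 G H _ (H-sym , _) (S , S-subdivides-H , S↪G) a (suc b) (_ , G-max) ((c , c-complete) , _)
  with subdivision-complete S-subdivides-H H-sym c-complete
... | _ , c-S , c-S-complete =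
  decidable-stable (suc b ≤? a) λ b≰a →
    greedy G (extend-coloring c-S) (extend-core c-S c-S-complete)
      λ (k , c′ , c′-complete , b≤k) → b≰a (ℕ.≤-trans b≤k (G-max k c′ c′-complete))
  where open InducedSubgraph {S} {G} S↪G
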